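{- Writing $a_m:=a_m(21;2\to 2)$, for $n\ge 1$ we have $a_n=d_n+\sum_{i=1}^{n}d_{n-i}\,a_{i-1}$, where $d_m$ is the $m$-th derangement number.
   Context: Standard cycle form of $\sigma\in S_n$: product of disjoint cycles (fixed points included), each cycle starting with its largest element, cycles listed in increasing order of largest elements. The fundamental bijection $\theta:S_n\to S_n$ erases the parentheses of the standard cycle form to give a one-line permutation. For $\pi\in S_n$, $\hat\pi=\theta^{ -1}(\pi)$. An arrow pattern $(\nu;H)$ of size $k$: a string $\nu=a_1\dots a_m$ of positive integers and a set $H$ of arrows $b\to c$, with all integers appearing forming $[k]$. $\pi\in S_n$ contains $(\nu;H)$ if there is $X=\{x_1<\dots<x_k\}\subseteq[n]$ with positions $t_1<\dots<t_m$ such that $\pi_{t_1}\cdots\pi_{t_m}=x_{a_1}\cdots x_{a_m}$ and $\hat\pi(x_b)=x_c$ for every arrow $b\to c\in H$; otherwise it avoids it. $a_n(\nu;H)$ = number of $\pi\in S_n$ avoiding $(\nu;H)$. $d_m$ = number of fixed-point-free permutations of $[m]$, with $d_0=1$; also $a_0=1$ (the empty permutation). -}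

module Defs where

open import Data.Nat as ℕ using (ℕ; zero; suc; _∸_; _*_; _+_)
open import Data.Fin as Fin using (Fin; _<_; _≤_; _≟_; _<?_; _≤?_)
open import Data.Fin.Properties using (any?; all?)
open import Data.Vec as Vec using (Vec; []; _∷_; lookup; toList)
open import Data.List as List using (List; []; _∷_; concat; filter; length; allFin)
import Data.List.Properties as LP
open import Data.List.Relation.Unary.All as All using (All)
open import Data.Product using (Σ; _×_; _,_; proj₁; proj₂)
open import Data.Bool using (if_then_else_)
open import Relation.Nullary using (Dec; ¬_; does)
open import Relation.Nullary.Decidable using (map′; _×-dec_; _→-dec_; ¬?)
open import Relation.Binary.PropositionalEquality using (_≡_)

-- Conventions: [n] = {1,…,n} is represented by Fin n = {0,…,n-1}
-- (order-preserving relabelling i ↦ i-1).  A permutation in one-line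
-- notation is a vector π : Vec (Fin n) n with π_i = lookup π i; the same
-- vector read as a function i ↦ lookup π i is the permutation as a map.

-- π is a permutation of [n] (injective, hence bijective, on a finite set)
IsPerm : ∀ {n} → Vec (Fin n) n → Set
IsPerm {n} π = ∀ (i j : Fin n) → lookup π i ≡ lookup π j → i ≡ j

allVecs : ∀ n k → List (Vec (Fin n) k)
allVecs n zero = [] ∷ []
allVecs n (suc k) =
  concat (List.map (λ i → List.map (i ∷_) (allVecs n k)) (allFin n))

isPerm? : ∀ {n} (π : Vec (Fin n) n) → Dec (IsPerm π)
isPerm? π = all? λ i → all? λ j → (lookup π i ≟ lookup π j) →-dec (i ≟ j)

S : (n : ℕ) → List (Vec (Fin n) n)
S n = filter isPerm? (allVecs n n)

cycleFrom : ∀ {n} → (Fin n → Fin n) → Fin n → ℕ → Fin n → List (Fin n)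
cycleFrom f m zero x = []
cycleFrom f m (suc fuel) x =
  x ∷ (if does (f x ≟ m) then [] else cycleFrom f m fuel (f x))

-- the cycle of σ containing m, written starting at m (n steps suffice)
cycleOf : ∀ {n} → Vec (Fin n) n → Fin n → List (Fin n)
cycleOf {n} σ m = cycleFrom (lookup σ) m n m

IsCycleMax : ∀ {n} → Vec (Fin n) n → Fin n → Set
IsCycleMax σ m = All (λ y → y ≤ m) (cycleOf σ m)

isCycleMax? : ∀ {n} (σ : Vec (Fin n) n) (m : Fin n) → Dec (IsCycleMax σ m)
isCycleMax? σ m = All.all? (λ y → y ≤? m) (cycleOf σ m)

standardCycleForm : ∀ {n} → Vec (Fin n) n → List (List (Fin n))
standardCycleForm {n} σ =
  List.map (cycleOf σ) (filter (isCycleMax? σ) (allFin n))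

θ : ∀ {n} → Vec (Fin n) n → List (Fin n)
θ σ = concat (standardCycleForm σ)

-- π̂(x) = y, where π̂ = θ⁻¹(π): the permutation σ with θ(σ) = π maps x to y
HatMaps : ∀ {n} → Vec (Fin n) n → Fin n → Fin n → Set
HatMaps {n} π x y =
  Σ (Vec (Fin n) n) λ σ → IsPerm σ × θ σ ≡ toList π × lookup σ x ≡ y

-- an arrow pattern (ν ; H) of size k; letters of [k] are Fin k
record ArrowPattern : Set where
  constructor mkPattern
  field
    k : ℕ
    m : ℕ
    ν : Vec (Fin k) m
    H : List (Fin k × Fin k)
open ArrowPattern public

StrictlyIncreasing : ∀ {n k} → Vec (Fin n) k → Set
StrictlyIncreasing {n} {k} x = ∀ (i j : Fin k) → i < j → lookup x i < lookup x j

Contains : ∀ {n} → Vec (Fin n) n → ArrowPattern → Set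
Contains {n} π p =
  Σ (Vec (Fin n) (k p)) λ x → StrictlyIncreasing x ×
  Σ (Vec (Fin n) (m p)) λ t → StrictlyIncreasing t ×
  (∀ (j : Fin (m p)) → lookup π (lookup t j) ≡ lookup x (lookup (ν p) j)) ×
  All (λ bc → HatMaps π (lookup x (proj₁ bc)) (lookup x (proj₂ bc))) (H p)

Avoids : ∀ {n} → Vec (Fin n) n → ArrowPattern → Set
Avoids π p = ¬ Contains π p

∃Vec? : ∀ {n} k {P : Vec (Fin n) k → Set} →
        (∀ v → Dec (P v)) → Dec (Σ (Vec (Fin n) k) P)
∃Vec? zero P? = map′ (λ p → [] , p) (λ { ([] , p) → p }) (P? [])
∃Vec? (suc k) P? =
  map′ (λ { (i , v , p) → (i ∷ v) , p }) (λ { ((i ∷ v) , p) → i , v , p })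
       (any? λ i → ∃Vec? k (λ v → P? (i ∷ v)))

strictlyIncreasing? : ∀ {n k} (x : Vec (Fin n) k) → Dec (StrictlyIncreasing x)
strictlyIncreasing? x =
  all? λ i → all? λ j → (i <? j) →-dec (lookup x i <? lookup x j)

hatMaps? : ∀ {n} (π : Vec (Fin n) n) x y → Dec (HatMaps π x y)
hatMaps? {n} π x y = ∃Vec? n λ σ →
  isPerm? σ ×-dec LP.≡-dec _≟_ (θ σ) (toList π) ×-dec (lookup σ x ≟ y)

contains? : ∀ {n} (π : Vec (Fin n) n) (p : ArrowPattern) → Dec (Contains π p)
contains? π p = ∃Vec? (k p) λ x → strictlyIncreasing? x ×-dec
  ∃Vec? (m p) λ t → strictlyIncreasing? t ×-dec
  (all? (λ j → lookup π (lookup t j) ≟ lookup x (lookup (ν p) j))) ×-dec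
  All.all? (λ bc → hatMaps? π (lookup x (proj₁ bc)) (lookup x (proj₂ bc))) (H p)

a : ArrowPattern → ℕ → ℕ
a p n = length (filter (λ π → ¬? (contains? π p)) (S n))

-- derangement numbers d_m (d_0 = 1: the empty permutation)

FixedPointFree : ∀ {n} → Vec (Fin n) n → Set
FixedPointFree {n} σ = ∀ (i : Fin n) → ¬ (lookup σ i ≡ i)

d : ℕ → ℕ
d n = length (filter (λ σ → all? λ i → ¬? (lookup σ i ≟ i)) (S n))

-- the pattern (21 ; 2 → 2): letters 1,2 are Fin.zero, Fin.suc Fin.zero

pat21-2→2 : ArrowPattern
pat21-2→2 = mkPattern 2 2 (Fin.suc Fin.zero ∷ Fin.zero ∷ [])
                          ((Fin.suc Fin.zero , Fin.suc Fin.zero) ∷ [])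

-- Write π = θ(σ), so σ = π̂. The standard cycle form lists the cycles of σ by increasing maxima,
-- so a fixed point u of σ is a one-element cycle, followed in π by exactly the cycles whose
-- maximum exceeds u. Hence π contains (21; 2 → 2) iff for some fixed point u some y < u lies on a
-- cycle with maximum above u; that is, π avoids the pattern iff σ maps {y < u} into itself for
-- every fixed point u, and a_n counts these σ. Sort them by their largest fixed point: if there is
-- none, σ is one of the d_n derangements; if it is i, then σ is a permutation of the same kind on
-- {1, …, i-1}, counted by a_(i-1), next to a derangement of the n - i points above i.

module Submission where

open import Defs
open import Data.Nat as ℕ using (ℕ; zero; suc; _≤_; _<_; _+_; _*_; _∸_; z≤n; s≤s; NonZero)
import Data.Nat.Properties as ℕ
open import Data.Nat.DivMod using (_%_; _/_; m≡m%n+[m/n]*n; m%n<n)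
open import Data.Nat.ListAction using (sum)
open import Data.Fin as Fin using (Fin; zero; suc; toℕ; _↑ˡ_; _↑ʳ_; splitAt; punchOut)
import Data.Fin.Properties as Fin
open import Data.Vec as Vec using (Vec; []; _∷_; lookup; toList; tabulate)
import Data.Vec.Properties as Vec
open import Data.List
  using (List; []; _∷_; _++_; map; concat; filter; length; allFin; applyUpTo; upTo; cartesianProduct)
import Data.List.Properties as List
import Data.List.Extrema as Extrema
import Data.List.Extrema.Nat as Extremaℕ
open import Data.List.Membership.Propositional using (_∈_; _∉_)
open import Data.List.Membership.Propositional.Properties
open import Data.List.Relation.Binary.Subset.Propositional using (_⊆_)
open import Data.List.Relation.Unary.Any using (here; there)
open import Data.List.Relation.Unary.All as All using (All; []; _∷_)
import Data.List.Relation.Unary.All.Properties as All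
open import Data.List.Relation.Unary.AllPairs as AllPairs using (AllPairs; []; _∷_)
import Data.List.Relation.Unary.AllPairs.Properties as AllPairs
open import Data.List.Relation.Unary.Unique.Propositional using (Unique)
import Data.List.Relation.Unary.Unique.Propositional.Properties as Unique
open import Data.Product using (_×_; _,_; ∃; ∃₂; proj₁; proj₂; uncurry)
open import Data.Sum as Sum using (_⊎_; inj₁; inj₂; fromInj₁; fromInj₂)
open import Data.Bool using (if_then_else_)
open import Data.Unit using (⊤; tt)
open import Data.Empty using (⊥)
open import Function using (_∘_; id; const)
open import Level using (0ℓ)
open import Relation.Nullary using (Dec; yes; no; does; ¬_; ¬?; contradiction)
open import Relation.Nullary.Decidable using (_→-dec_)
open import Relation.Unary using (Pred; Decidable)
open import Relation.Unary.Properties using (∁?)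
open import Relation.Binary.Definitions using (tri<; tri≈; tri>)
open import Relation.Binary.PropositionalEquality

private
  variable
    A B : Set

-- Counting finite lists

InjectiveOn : (A → B) → List A → Set
InjectiveOn f xs = ∀ {x y} → x ∈ xs → y ∈ xs → f x ≡ f y → x ≡ y

length-mono-⊆ : {xs ys : List A} → Unique xs → xs ⊆ ys → length xs ≤ length ys
length-mono-⊆ {xs = []}     _            _     = z≤n
length-mono-⊆ {xs = x ∷ xs} (x∉xs ∷ xs!) xs⊆ys with ∈-∃++ (xs⊆ys (here refl))
... | ys₁ , ys₂ , refl = begin
  suc (length xs)           ≤⟨ s≤s (length-mono-⊆ xs! xs⊆ys₁ys₂) ⟩
  suc (length (ys₁ ++ ys₂)) ≡⟨ List.length-++-sucʳ ys₁ x ys₂ ⟨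
  length (ys₁ ++ x ∷ ys₂)   ∎
  where
  open ℕ.≤-Reasoning
  xs⊆ys₁ys₂ : xs ⊆ ys₁ ++ ys₂
  xs⊆ys₁ys₂ y∈xs with ∈-++⁻ ys₁ (xs⊆ys (there y∈xs))
  ... | inj₁ y∈ys₁         = ∈-++⁺ˡ y∈ys₁
  ... | inj₂ (here refl)   = contradiction refl (All.lookup x∉xs y∈xs)
  ... | inj₂ (there y∈ys₂) = ∈-++⁺ʳ ys₁ y∈ys₂

Unique-map⁺ : {f : A → B} {xs : List A} → InjectiveOn f xs → Unique xs → Unique (map f xs)
Unique-map⁺ {xs = []}     _   []           = []
Unique-map⁺ {xs = x ∷ xs} inj (x∉xs ∷ xs!) =
  All.map⁺ (All.tabulate λ y∈xs fx≡fy → All.lookup x∉xs y∈xs (inj (here refl) (there y∈xs) fx≡fy))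
  ∷ Unique-map⁺ (λ p q → inj (there p) (there q)) xs!

length-≤-injection : {f : A → B} {xs : List A} {ys : List B} → Unique xs → InjectiveOn f xs →
                     (∀ {x} → x ∈ xs → f x ∈ ys) → length xs ≤ length ys
length-≤-injection {f = f} {xs} {ys} xs! inj into = begin
  length xs         ≡⟨ List.length-map f xs ⟨
  length (map f xs) ≤⟨ length-mono-⊆ (Unique-map⁺ inj xs!) fxs⊆ys ⟩
  length ys         ∎
  where
  open ℕ.≤-Reasoning
  fxs⊆ys : map f xs ⊆ ys
  fxs⊆ys fx∈ with ∈-map⁻ f fx∈
  ... | x , x∈xs , refl = into x∈xs

length-≡-inverses : (f : A → B) (g : B → A) {xs : List A} {ys : List B} → Unique xs → Unique ys →
                    (∀ {x} → x ∈ xs → f x ∈ ys) → (∀ {y} → y ∈ ys → g y ∈ xs) →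
                    (∀ {x} → x ∈ xs → g (f x) ≡ x) → (∀ {y} → y ∈ ys → f (g y) ≡ y) →
                    length xs ≡ length ys
length-≡-inverses f g xs! ys! f∈ g∈ g∘f fg∘g = ℕ.≤-antisym
  (length-≤-injection xs! (λ p q e → trans (sym (g∘f p)) (trans (cong g e) (g∘f q))) f∈)
  (length-≤-injection ys! (λ p q e → trans (sym (fg∘g p)) (trans (cong f e) (fg∘g q))) g∈)

length-cartesianProduct : (xs : List A) (ys : List B) → length (cartesianProduct xs ys) ≡ length xs * length ys
length-cartesianProduct []       ys = refl
length-cartesianProduct (x ∷ xs) ys = begin
  length (map (x ,_) ys ++ cartesianProduct xs ys)
    ≡⟨ List.length-++ (map (x ,_) ys) ⟩
  length (map (x ,_) ys) + length (cartesianProduct xs ys)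
    ≡⟨ cong₂ _+_ (List.length-map (x ,_) ys) (length-cartesianProduct xs ys) ⟩
  length ys + length xs * length ys
    ∎
  where open ≡-Reasoning

length-filter-∁ : {P : Pred A 0ℓ} (P? : Decidable P) (xs : List A) →
                  length (filter P? xs) + length (filter (∁? P?) xs) ≡ length xs
length-filter-∁ P? []       = refl
length-filter-∁ P? (x ∷ xs) with P? x
... | yes _ = cong suc (length-filter-∁ P? xs)
... | no  _ = trans (ℕ.+-suc _ _) (cong suc (length-filter-∁ P? xs))

-- Injectivity only gives ≤ for P and for its complement; the two totals agree, so both are equalities.
length-filter-transport : {P Q : Pred A 0ℓ} (P? : Decidable P) (Q? : Decidable Q) (f : A → A) {xs : List A} →
                          Unique xs → InjectiveOn f xs → (∀ {x} → x ∈ xs → f x ∈ xs) →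
                          (∀ {x} → x ∈ xs → P x → Q (f x)) → (∀ {x} → x ∈ xs → ¬ P x → ¬ Q (f x)) →
                          length (filter P? xs) ≡ length (filter Q? xs)
length-filter-transport P? Q? f {xs} xs! inj into P⇒Q ¬P⇒¬Q =
  cancel (length-≤ P? Q? P⇒Q) (length-≤ (∁? P?) (∁? Q?) ¬P⇒¬Q)
         (trans (length-filter-∁ P? xs) (sym (length-filter-∁ Q? xs)))
  where
  length-≤ : {P′ Q′ : Pred _ 0ℓ} (P′? : Decidable P′) (Q′? : Decidable Q′) →
             (∀ {x} → x ∈ xs → P′ x → Q′ (f x)) → length (filter P′? xs) ≤ length (filter Q′? xs)
  length-≤ P′? Q′? P′⇒Q′ = length-≤-injection (Unique.filter⁺ P′? xs!)
    (λ p q → inj (proj₁ (∈-filter⁻ P′? p)) (proj₁ (∈-filter⁻ P′? q)))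
    (λ p → let x∈xs , P′x = ∈-filter⁻ P′? p in ∈-filter⁺ Q′? (into x∈xs) (P′⇒Q′ x∈xs P′x))
  cancel : ∀ {a b c e} → a ≤ c → b ≤ e → a + b ≡ c + e → a ≡ c
  cancel a≤c b≤e a+b≡c+e = ℕ.≤-antisym a≤c (ℕ.≮⇒≥ λ a<c → ℕ.<-irrefl a+b≡c+e (ℕ.+-mono-<-≤ a<c b≤e))

module _ (key : A → ℕ) where

  fibreSizes : List A → List ℕ → List ℕ
  fibreSizes xs = map (λ i → length (filter (λ x → key x ℕ.≟ i) xs))

  private
    sum-fibreSizes-∉ : ∀ {x} xs ks → key x ∉ ks → sum (fibreSizes (x ∷ xs) ks) ≡ sum (fibreSizes xs ks)
    sum-fibreSizes-∉     xs []       _   = refl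
    sum-fibreSizes-∉ {x} xs (i ∷ ks) x∉ = cong₂ _+_
      (cong length (List.filter-reject (λ x → key x ℕ.≟ i) (x∉ ∘ here)))
      (sum-fibreSizes-∉ xs ks (x∉ ∘ there))

    sum-fibreSizes-∈ : ∀ {x} xs ks → Unique ks → key x ∈ ks →
                       sum (fibreSizes (x ∷ xs) ks) ≡ suc (sum (fibreSizes xs ks))
    sum-fibreSizes-∈ {x} xs (i ∷ ks) (i∉ks ∷ ks!) x∈ with key x ℕ.≟ i
    ... | yes refl = cong₂ _+_
      (cong length (List.filter-accept (λ x → key x ℕ.≟ i) refl))
      (sum-fibreSizes-∉ xs ks (λ p → All.lookup i∉ks p refl))
    ... | no  x≢i = begin
      sum (fibreSizes (x ∷ xs) (i ∷ ks))
        ≡⟨ cong₂ _+_ (cong length (List.filter-reject (λ x → key x ℕ.≟ i) x≢i))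
                     (sum-fibreSizes-∈ xs ks ks! (x∈ks x∈)) ⟩
      length (filter (λ x → key x ℕ.≟ i) xs) + suc (sum (fibreSizes xs ks))
        ≡⟨ ℕ.+-suc _ _ ⟩
      suc (sum (fibreSizes xs (i ∷ ks)))
        ∎
      where
      open ≡-Reasoning
      x∈ks : key x ∈ i ∷ ks → key x ∈ ks
      x∈ks (here x≡i) = contradiction x≡i x≢i
      x∈ks (there p)  = p

  length-≡-sum-fibreSizes : ∀ xs ks → Unique ks → (∀ {x} → x ∈ xs → key x ∈ ks) →
                            length xs ≡ sum (fibreSizes xs ks)
  length-≡-sum-fibreSizes []       ks _   _     = sym (sum-zeros ks)
    where
    sum-zeros : ∀ ks → sum (fibreSizes [] ks) ≡ 0
    sum-zeros []       = refl
    sum-zeros (_ ∷ ks) = sum-zeros ks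
  length-≡-sum-fibreSizes (x ∷ xs) ks ks! keys∈ = begin
    suc (length xs)              ≡⟨ cong suc (length-≡-sum-fibreSizes xs ks ks! (keys∈ ∘ there)) ⟩
    suc (sum (fibreSizes xs ks)) ≡⟨ sum-fibreSizes-∈ xs ks ks! (keys∈ (here refl)) ⟨
    sum (fibreSizes (x ∷ xs) ks) ∎
    where open ≡-Reasoning

Unique-concat-map⁺ : {P : A → Set} {c : A → List B} {xs : List A} → Unique xs → All P xs →
                     (∀ {x} → P x → Unique (c x)) → (∀ {x y z} → P x → P y → z ∈ c x → z ∈ c y → x ≡ y) →
                     Unique (concat (map c xs))
Unique-concat-map⁺ {xs = []}             _            _          _        _          = []
Unique-concat-map⁺ {c = c} {xs = x ∷ xs} (x∉xs ∷ xs!) (Px ∷ Pxs) c-unique c-disjoint =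
  Unique.++⁺ (c-unique Px) (Unique-concat-map⁺ xs! Pxs c-unique c-disjoint) disjoint
  where
  disjoint : ∀ {z} → ¬ (z ∈ c x × z ∈ concat (map c xs))
  disjoint (z∈cx , z∈rest) with ∈-concat⁻′ (map c xs) z∈rest
  ... | _ , z∈cy , cy∈ with ∈-map⁻ c cy∈
  ...   | y , y∈xs , refl = All.lookup x∉xs y∈xs (c-disjoint Px (All.lookup Pxs y∈xs) z∈cx z∈cy)

-- Enumerating permutations and reading vectors as lists

∈-allVecs : ∀ n k (v : Vec (Fin n) k) → v ∈ allVecs n k
∈-allVecs n zero    []      = here refl
∈-allVecs n (suc k) (i ∷ v) =
  ∈-concat⁺′ (∈-map⁺ (i ∷_) (∈-allVecs n k v)) (∈-map⁺ (λ i → map (i ∷_) (allVecs n k)) (∈-allFin i))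

allVecs-unique : ∀ n k → Unique (allVecs n k)
allVecs-unique n zero    = [] ∷ []
allVecs-unique n (suc k) = Unique.concat⁺
  (All.map⁺ (All.tabulate λ _ → Unique.map⁺ (cong Vec.tail) (allVecs-unique n k)))
  (AllPairs.map⁺ (AllPairs.map disjoint (Unique.allFin⁺ n)))
  where
  disjoint : ∀ {i j} → i ≢ j → ∀ {v} → ¬ (v ∈ map (i ∷_) (allVecs n k) × v ∈ map (j ∷_) (allVecs n k))
  disjoint i≢j (p , q) with ∈-map⁻ _ p | ∈-map⁻ _ q
  ... | _ , _ , refl | _ , _ , e = i≢j (cong Vec.head e)

∈-S⁺ : ∀ {n} {σ : Vec (Fin n) n} → IsPerm σ → σ ∈ S n
∈-S⁺ {n} {σ} = ∈-filter⁺ isPerm? (∈-allVecs n n σ)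

∈-S⁻ : ∀ {n} {σ : Vec (Fin n) n} → σ ∈ S n → IsPerm σ
∈-S⁻ {n} = proj₂ ∘ ∈-filter⁻ isPerm? {xs = allVecs n n}

S-unique : ∀ n → Unique (S n)
S-unique n = Unique.filter⁺ isPerm? (allVecs-unique n n)

lookup-ext : ∀ {n} {u v : Vec A n} → (∀ i → lookup u i ≡ lookup v i) → u ≡ v
lookup-ext {u = u} {v} u≗v = begin
  u                       ≡⟨ Vec.tabulate∘lookup u ⟨
  tabulate (lookup u)     ≡⟨ Vec.tabulate-cong u≗v ⟩
  tabulate (lookup v)     ≡⟨ Vec.tabulate∘lookup v ⟩
  v                       ∎
  where open ≡-Reasoning

lookup-∈-toList : ∀ {n} (v : Vec A n) i → lookup v i ∈ toList v
lookup-∈-toList (x ∷ v) zero    = here refl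
lookup-∈-toList (x ∷ v) (suc i) = there (lookup-∈-toList v i)

∈-toList⇒lookup : ∀ {n} (v : Vec A n) {y} → y ∈ toList v → ∃ λ i → lookup v i ≡ y
∈-toList⇒lookup (x ∷ v) (here refl) = zero , refl
∈-toList⇒lookup (x ∷ v) (there y∈)  with ∈-toList⇒lookup v y∈
... | i , e = suc i , e

Unique⇒lookup-injective : ∀ {n} (v : Vec A n) → Unique (toList v) → ∀ i j → lookup v i ≡ lookup v j → i ≡ j
Unique⇒lookup-injective (x ∷ v) _         zero    zero    _ = refl
Unique⇒lookup-injective (x ∷ v) (x∉v ∷ _) zero    (suc j) e =
  contradiction e (All.lookup x∉v (lookup-∈-toList v j))
Unique⇒lookup-injective (x ∷ v) (x∉v ∷ _) (suc i) zero    e =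
  contradiction (sym e) (All.lookup x∉v (lookup-∈-toList v i))
Unique⇒lookup-injective (x ∷ v) (_ ∷ v!)  (suc i) (suc j) e = cong suc (Unique⇒lookup-injective v v! i j e)

Precedes : List A → A → A → Set
Precedes xs u v = ∃₂ λ ys zs → xs ≡ ys ++ u ∷ zs × v ∈ zs

lookup-precedes : ∀ {n} (v : Vec A n) {p q} → p Fin.< q → Precedes (toList v) (lookup v p) (lookup v q)
lookup-precedes (x ∷ v) {zero}  {suc q} _         = [] , toList v , refl , lookup-∈-toList v q
lookup-precedes (x ∷ v) {suc p} {suc q} (s≤s p<q) with lookup-precedes v p<q
... | ys , zs , e , v∈zs = x ∷ ys , zs , cong (x ∷_) e , v∈zs

precedes⇒lookup : ∀ {n} (v : Vec A n) {x y} → Precedes (toList v) x y →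
                  ∃₂ λ p q → p Fin.< q × lookup v p ≡ x × lookup v q ≡ y
precedes⇒lookup (x ∷ v) ([] , zs , refl , y∈zs) with ∈-toList⇒lookup v y∈zs
... | q , e = zero , suc q , s≤s z≤n , refl , e
precedes⇒lookup (x ∷ v) (_ ∷ ys , zs , e , y∈zs) with precedes⇒lookup v (ys , zs , List.∷-injectiveʳ e , y∈zs)
... | p , q , p<q , e₁ , e₂ = suc p , suc q , s≤s p<q , e₁ , e₂

precedes-unique : ∀ (xs : List A) {u ys v} → Unique (xs ++ u ∷ ys) → Precedes (xs ++ u ∷ ys) u v → v ∈ ys
precedes-unique xs xs! (ys′ , zs , e , v∈zs) = subst (_ ∈_) (suffix-unique xs ys′ xs! (sym e)) v∈zs
  where
  suffix-unique : ∀ xs ys′ {u ys zs} → Unique (xs ++ u ∷ ys) → ys′ ++ u ∷ zs ≡ xs ++ u ∷ ys → zs ≡ ys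
  suffix-unique []       []        _          e = List.∷-injectiveʳ e
  suffix-unique (x ∷ xs) []        (x∉ ∷ _)   e =
    contradiction (sym (List.∷-injectiveˡ e)) (All.lookup x∉ (∈-insert xs))
  suffix-unique []       (y ∷ ys′) (u∉ ∷ _)   e =
    contradiction refl (All.lookup u∉ (subst (_ ∈_) (List.∷-injectiveʳ e) (∈-insert ys′)))
  suffix-unique (x ∷ xs) (y ∷ ys′) (_ ∷ xs!) e = suffix-unique xs ys′ xs! (List.∷-injectiveʳ e)

AllPairs-pivot : ∀ {R : A → A → Set} (xs : List A) {y ys} → AllPairs R (xs ++ y ∷ ys) →
                 All (λ x → R x y) xs × All (R y) ys
AllPairs-pivot []       (y-ys ∷ _)      = [] , y-ys
AllPairs-pivot (x ∷ xs) (x-rest ∷ rest) with AllPairs-pivot xs rest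
... | xs-y , y-ys = All.lookup x-rest (∈-insert xs) ∷ xs-y , y-ys

-- Orbits of a permutation

module _ (f : A → A) where

  iterate : ℕ → A → A
  iterate zero    x = x
  iterate (suc k) x = iterate k (f x)

  iterate-+ : ∀ i j x → iterate (i + j) x ≡ iterate j (iterate i x)
  iterate-+ zero    j x = refl
  iterate-+ (suc i) j x = iterate-+ i j (f x)

  iterate-suc : ∀ k x → iterate (suc k) x ≡ f (iterate k x)
  iterate-suc zero    x = refl
  iterate-suc (suc k) x = iterate-suc k (f x)

module _ {n} (f : Fin n → Fin n) (m : Fin n) where

  record CycleFromView (fuel : ℕ) (y : Fin n) : Set where
    field
      len      : ℕ
      shape    : cycleFrom f m fuel y ≡ applyUpTo (λ i → iterate f i y) len
      misses   : ∀ j → suc j < len → iterate f (suc j) y ≢ m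
      stops    : iterate f len y ≡ m ⊎ len ≡ fuel
      nonempty : 0 < fuel → 0 < len

  cycleFrom-view : ∀ fuel y → CycleFromView fuel y
  cycleFrom-view zero y = record
    { len = 0 ; shape = refl ; misses = λ _ () ; stops = inj₂ refl ; nonempty = λ () }
  cycleFrom-view (suc fuel) y with f y Fin.≟ m in eq
  ... | yes fy≡m = record
    { len      = 1
    ; shape    = cong (λ q → y ∷ (if does q then [] else cycleFrom f m fuel (f y))) eq
    ; misses   = λ { _ (s≤s ()) }
    ; stops    = inj₁ fy≡m
    ; nonempty = λ _ → s≤s z≤n }
  ... | no fy≢m = record
    { len      = suc len
    ; shape    = trans (cong (λ q → y ∷ (if does q then [] else cycleFrom f m fuel (f y))) eq) (cong (y ∷_) shape)
    ; misses   = λ { zero _ → fy≢m ; (suc j) (s≤s j<len) → misses j j<len }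
    ; stops    = Sum.map id (cong suc) stops
    ; nonempty = λ _ → s≤s z≤n }
    where open CycleFromView (cycleFrom-view fuel (f y))

cycleOf-fixed : ∀ {n} (σ : Vec (Fin n) n) {u} → lookup σ u ≡ u → cycleOf σ u ≡ u ∷ []
cycleOf-fixed {suc n} σ {u} σu≡u with lookup σ u Fin.≟ u
... | yes _   = refl
... | no σu≢u = contradiction σu≡u σu≢u

cycleMaxima : ∀ {n} → Vec (Fin n) n → List (Fin n)
cycleMaxima {n} σ = filter (isCycleMax? σ) (allFin n)

∈-cycleMaxima⁺ : ∀ {n} (σ : Vec (Fin n) n) {M} → IsCycleMax σ M → M ∈ cycleMaxima σ
∈-cycleMaxima⁺ σ {M} = ∈-filter⁺ (isCycleMax? σ) (∈-allFin M)

∈-cycleMaxima⁻ : ∀ {n} (σ : Vec (Fin n) n) {M} → M ∈ cycleMaxima σ → IsCycleMax σ M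
∈-cycleMaxima⁻ {n} σ = proj₂ ∘ ∈-filter⁻ (isCycleMax? σ) {xs = allFin n}

cycleMaxima-sorted : ∀ {n} (σ : Vec (Fin n) n) → AllPairs Fin._<_ (cycleMaxima σ)
cycleMaxima-sorted σ = AllPairs.filter⁺ (isCycleMax? σ) (AllPairs.tabulate⁺-< id)

module Orbits {n} (σ : Vec (Fin n) n) (σ-perm : IsPerm σ) where

  private
    f : Fin n → Fin n
    f = lookup σ

  iterate-injective : ∀ k {x y} → iterate f k x ≡ iterate f k y → x ≡ y
  iterate-injective zero    e = e
  iterate-injective (suc k) e = σ-perm _ _ (iterate-injective k e)

  returns-within-n : ∀ m → ∃ λ k → 0 < k × k ≤ n × iterate f k m ≡ m
  returns-within-n m with Fin.pigeonhole (ℕ.n<1+n n) (λ (i : Fin (suc n)) → iterate f (toℕ i) m)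
  ... | i , j , i<j , fⁱm≡fʲm = gap , ℕ.m<n⇒0<n∸m i<j , gap≤n , sym (iterate-injective (toℕ i) fⁱm≡fⁱ⁺ᵍᵃᵖm)
    where
    gap : ℕ
    gap = toℕ j ∸ toℕ i
    gap≤n : gap ≤ n
    gap≤n = ℕ.≤-trans (ℕ.m∸n≤m (toℕ j) (toℕ i)) (ℕ.≤-pred (Fin.toℕ<n j))
    fⁱm≡fⁱ⁺ᵍᵃᵖm : iterate f (toℕ i) m ≡ iterate f (toℕ i) (iterate f gap m)
    fⁱm≡fⁱ⁺ᵍᵃᵖm = begin
      iterate f (toℕ i) m                 ≡⟨ fⁱm≡fʲm ⟩
      iterate f (toℕ j) m                 ≡⟨ cong (λ k → iterate f k m) (ℕ.m∸n+n≡m (ℕ.<⇒≤ i<j)) ⟨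
      iterate f (gap + toℕ i) m           ≡⟨ iterate-+ f gap (toℕ i) m ⟩
      iterate f (toℕ i) (iterate f gap m) ∎
      where open ≡-Reasoning

  record Period (m : Fin n) : Set where
    field
      len        : ℕ
      len>0      : 0 < len
      returns-at : iterate f len m ≡ m
      minimal    : ∀ j → suc j < len → iterate f (suc j) m ≢ m
      shape      : cycleOf σ m ≡ applyUpTo (λ i → iterate f i m) len

  -- cycleOf gives up after n steps; by returns-within-n the cycle has closed by then.
  period : ∀ m → Period m
  period m = record
    { len        = len
    ; len>0      = nonempty (ℕ.≤-<-trans z≤n (Fin.toℕ<n m))
    ; returns-at = returns-at
    ; minimal    = misses
    ; shape      = shape }
    where
    open CycleFromView (cycleFrom-view f m n m)
    returns-at : iterate f len m ≡ m
    returns-at with stops | returns-within-n m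
    ... | inj₁ fˡᵉⁿm≡m | _ = fˡᵉⁿm≡m
    ... | inj₂ len≡n   | suc k , _ , k<n , fᵏm≡m with ℕ.<-cmp (suc k) len
    ...   | tri< k<len _ _ = contradiction fᵏm≡m (misses k k<len)
    ...   | tri≈ _ k≡len _ = subst (λ i → iterate f i m ≡ m) k≡len fᵏm≡m
    ...   | tri> _ _ len<k = contradiction k<n (ℕ.<⇒≱ (subst (_< suc k) len≡n len<k))

  module _ (m : Fin n) where
    open Period (period m)

    iterate-len-multiple : ∀ q → iterate f (q * len) m ≡ m
    iterate-len-multiple zero    = refl
    iterate-len-multiple (suc q) = begin
      iterate f (len + q * len) m           ≡⟨ iterate-+ f len (q * len) m ⟩
      iterate f (q * len) (iterate f len m) ≡⟨ cong (iterate f (q * len)) returns-at ⟩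
      iterate f (q * len) m                 ≡⟨ iterate-len-multiple q ⟩
      m                                     ∎
      where open ≡-Reasoning

    ∈-cycleOf⁺ : ∀ j → iterate f j m ∈ cycleOf σ m
    ∈-cycleOf⁺ j = subst (iterate f j m ∈_) (sym shape) (subst (_∈ _) fʳm≡fʲm (∈-applyUpTo⁺ _ (m%n<n j len)))
      where
      instance
        len-nonZero : NonZero len
        len-nonZero = ℕ.>-nonZero len>0
      fʳm≡fʲm : iterate f (j % len) m ≡ iterate f j m
      fʳm≡fʲm = begin
        iterate f (j % len) m
          ≡⟨ cong (iterate f (j % len)) (iterate-len-multiple (j / len)) ⟨
        iterate f (j % len) (iterate f (j / len * len) m)
          ≡⟨ iterate-+ f (j / len * len) (j % len) m ⟨
        iterate f (j / len * len + j % len) m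
          ≡⟨ cong (λ i → iterate f i m) (trans (ℕ.+-comm (j / len * len) (j % len)) (sym (m≡m%n+[m/n]*n j len))) ⟩
        iterate f j m
          ∎
        where open ≡-Reasoning

    ∈-cycleOf⁻ : ∀ {z} → z ∈ cycleOf σ m → ∃ λ i → i < len × iterate f i m ≡ z
    ∈-cycleOf⁻ z∈ with ∈-applyUpTo⁻ _ (subst (_ ∈_) shape z∈)
    ... | i , i<len , refl = i , i<len , refl

    cycleOf-unique : Unique (cycleOf σ m)
    cycleOf-unique = subst Unique (sym shape) (Unique.applyUpTo⁺₁ _ len distinct)
      where
      distinct : ∀ {i j} → i < j → j < len → iterate f i m ≢ iterate f j m
      distinct {i} i<j j<len fⁱm≡fʲm with ℕ.m≤n⇒∃[o]m+o≡n i<j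
      ... | o , refl = minimal o (ℕ.≤-<-trans (s≤s (ℕ.m≤n+m o i)) j<len) (sym (iterate-injective i (begin
        iterate f i m                     ≡⟨ fⁱm≡fʲm ⟩
        iterate f (suc i + o) m           ≡⟨ cong (λ k → iterate f (suc k) m) (ℕ.+-comm i o) ⟩
        iterate f (suc o + i) m           ≡⟨ iterate-+ f (suc o) i m ⟩
        iterate f i (iterate f (suc o) m) ∎)))
        where open ≡-Reasoning

  cycleOf-closed : ∀ {m z} → z ∈ cycleOf σ m → f z ∈ cycleOf σ m
  cycleOf-closed {m} z∈ with ∈-cycleOf⁻ m z∈
  ... | i , _ , refl = subst (_∈ cycleOf σ m) (iterate-suc f i m) (∈-cycleOf⁺ m (suc i))

  cycleOf-trans : ∀ {m z w} → z ∈ cycleOf σ m → w ∈ cycleOf σ z → w ∈ cycleOf σ m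
  cycleOf-trans {m} z∈ w∈ with ∈-cycleOf⁻ m z∈
  ... | i , _ , refl with ∈-cycleOf⁻ _ w∈
  ...   | j , _ , refl = subst (_∈ cycleOf σ m) (iterate-+ f i j m) (∈-cycleOf⁺ m (i + j))

  cycleOf-sym : ∀ {m z} → z ∈ cycleOf σ m → m ∈ cycleOf σ z
  cycleOf-sym {m} z∈
    with ∈-cycleOf⁻ m z∈ | Period.len (period m) | Period.len>0 (period m) | iterate-len-multiple m
  ... | i , _ , refl | suc ℓ | _ | len-multiple = subst (_∈ cycleOf σ (iterate f i m)) (begin
        iterate f (i * ℓ) (iterate f i m) ≡⟨ iterate-+ f i (i * ℓ) m ⟨
        iterate f (i + i * ℓ) m           ≡⟨ cong (λ k → iterate f k m) (ℕ.*-suc i ℓ) ⟨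
        iterate f (i * suc ℓ) m           ≡⟨ len-multiple i ⟩
        m                                 ∎)
      (∈-cycleOf⁺ _ (i * ℓ))
    where open ≡-Reasoning

  cycleOf-leader : ∀ z → ∃ λ M → IsCycleMax σ M × z ∈ cycleOf σ M
  cycleOf-leader z = M , All.tabulate (All.lookup (FinExtrema.xs≤max z _) ∘ cycleOf-trans M∈) , cycleOf-sym M∈
    where
    module FinExtrema = Extrema (Fin.≤-totalOrder n)
    M : Fin n
    M = FinExtrema.max z (cycleOf σ z)
    M∈ : M ∈ cycleOf σ z
    M∈ with FinExtrema.argmax-sel id z (cycleOf σ z)
    ... | inj₁ M≡z = subst (_∈ cycleOf σ z) (sym M≡z) (∈-cycleOf⁺ z 0)
    ... | inj₂ M∈′ = M∈′

  same-leader : ∀ {M M′ z} → IsCycleMax σ M → IsCycleMax σ M′ → z ∈ cycleOf σ M → z ∈ cycleOf σ M′ → M ≡ M′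
  same-leader M-max M′-max z∈M z∈M′ = Fin.≤-antisym
    (All.lookup M′-max (cycleOf-trans z∈M′ (cycleOf-sym z∈M)))
    (All.lookup M-max (cycleOf-trans z∈M (cycleOf-sym z∈M′)))

  θ-complete : ∀ z → z ∈ θ σ
  θ-complete z with cycleOf-leader z
  ... | M , M-max , z∈ = ∈-concat⁺′ z∈ (∈-map⁺ (cycleOf σ) (∈-cycleMaxima⁺ σ M-max))

  θ-unique : Unique (θ σ)
  θ-unique = Unique-concat-map⁺ (Unique.filter⁺ (isCycleMax? σ) (Unique.allFin⁺ n))
    (All.tabulate (∈-cycleMaxima⁻ σ)) (λ {M} _ → cycleOf-unique M) same-leader

  length-θ : length (θ σ) ≡ n
  length-θ = begin
    length (θ σ)      ≡⟨ ℕ.≤-antisym (length-mono-⊆ θ-unique (λ _ → ∈-allFin _))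
                                     (length-mono-⊆ (Unique.allFin⁺ n) (λ _ → θ-complete _)) ⟩
    length (allFin n) ≡⟨ List.length-tabulate id ⟩
    n                 ∎
    where open ≡-Reasoning

applyUpTo-≡⁻ : ∀ (g h : ℕ → A) {len} → applyUpTo g len ≡ applyUpTo h len → ∀ {i} → i < len → g i ≡ h i
applyUpTo-≡⁻ g h {suc len} e {zero}  _           = List.∷-injectiveˡ e
applyUpTo-≡⁻ g h {suc len} e {suc i} (s≤s i<len) = applyUpTo-≡⁻ (g ∘ suc) (h ∘ suc) (List.∷-injectiveʳ e) i<len

cycleOf-determines : ∀ {n} (σ τ : Vec (Fin n) n) → IsPerm σ → IsPerm τ → ∀ {M z} →
                     cycleOf σ M ≡ cycleOf τ M → z ∈ cycleOf σ M → lookup σ z ≡ lookup τ z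
cycleOf-determines σ τ σ-perm τ-perm {M} cσ≡cτ z∈ with Orbits.∈-cycleOf⁻ σ σ-perm M z∈
... | i , i<len , refl = begin
  lookup σ (iterate (lookup σ) i M) ≡⟨ iterate-suc (lookup σ) i M ⟨
  iterate (lookup σ) (suc i) M      ≡⟨ iterates-agree (suc i) i<len ⟩
  iterate (lookup τ) (suc i) M      ≡⟨ iterate-suc (lookup τ) i M ⟩
  lookup τ (iterate (lookup τ) i M) ≡⟨ cong (lookup τ) (iterates-agree i (ℕ.<⇒≤ i<len)) ⟨
  lookup τ (iterate (lookup σ) i M) ∎
  where
  open ≡-Reasoning
  module Pσ = Orbits.Period (Orbits.period σ σ-perm M)
  module Pτ = Orbits.Period (Orbits.period τ τ-perm M)
  shapes : applyUpTo (λ j → iterate (lookup σ) j M) Pσ.len ≡ applyUpTo (λ j → iterate (lookup τ) j M) Pτ.len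
  shapes = trans (sym Pσ.shape) (trans cσ≡cτ Pτ.shape)
  same-len : Pσ.len ≡ Pτ.len
  same-len = trans (sym (List.length-applyUpTo _ Pσ.len))
                   (trans (cong length shapes) (List.length-applyUpTo _ Pτ.len))
  iterates-agree : ∀ j → j ≤ Pσ.len → iterate (lookup σ) j M ≡ iterate (lookup τ) j M
  iterates-agree j j≤len with ℕ.m≤n⇒m<n∨m≡n j≤len
  ... | inj₁ j<len = applyUpTo-≡⁻ _ _ (trans shapes (cong (applyUpTo _) (sym same-len))) j<len
  ... | inj₂ refl  = trans Pσ.returns-at
                            (sym (subst (λ k → iterate (lookup τ) k M ≡ M) (sym same-len) Pτ.returns-at))

-- The fundamental bijection θ

module _ {n : ℕ} where

  Above : Fin n → List (Fin n) → Set
  Above h []      = ⊤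
  Above h (x ∷ _) = h Fin.< x

  data Blocks : List (List (Fin n)) → Set where
    []    : Blocks []
    block : ∀ {h t bs} → All (Fin._≤ h) t → Above h (concat bs) → Blocks bs → Blocks ((h ∷ t) ∷ bs)

  private
    ++-cancel-below : ∀ {h} t t′ {r r′} → All (Fin._≤ h) t → All (Fin._≤ h) t′ → Above h r → Above h r′ →
                      t ++ r ≡ t′ ++ r′ → t ≡ t′ × r ≡ r′
    ++-cancel-below []      []        _          _           _   _   e    = refl , e
    ++-cancel-below []      (x ∷ t′)  _          (x≤h ∷ _)   h<x _   refl = contradiction x≤h (ℕ.<⇒≱ h<x)
    ++-cancel-below (x ∷ t) []        (x≤h ∷ _)  _           _   h<x refl = contradiction x≤h (ℕ.<⇒≱ h<x)
    ++-cancel-below (x ∷ t) (x′ ∷ t′) (_ ∷ t≤h) (_ ∷ t′≤h) a   a′  e    with List.∷-injective e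
    ... | refl , e′ with ++-cancel-below t t′ t≤h t′≤h a a′ e′
    ...   | refl , r≡r′ = refl , r≡r′

  concat-injective : ∀ {bs bs′} → Blocks bs → Blocks bs′ → concat bs ≡ concat bs′ → bs ≡ bs′
  concat-injective []               []                  _  = refl
  concat-injective []               (block _ _ _)       ()
  concat-injective (block _ _ _)    []                  ()
  concat-injective (block t≤h a bs) (block t′≤h a′ bs′) e  with List.∷-injective e
  ... | refl , e′ with ++-cancel-below _ _ t≤h t′≤h a a′ e′
  ...   | refl , rest≡ = cong (_ ∷_) (concat-injective bs bs′ rest≡)

cycleOf-blocks : ∀ {n} (σ : Vec (Fin n) n) {hs} → AllPairs Fin._<_ hs → All (IsCycleMax σ) hs →
                 Blocks (map (cycleOf σ) hs)
cycleOf-blocks         σ []           []               = []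
cycleOf-blocks {suc n} σ (h<hs ∷ hs<) (h-max ∷ hs-max) =
  block (All.tail h-max) (above h<hs) (cycleOf-blocks σ hs< hs-max)
  where
  above : ∀ {h hs} → All (h Fin.<_) hs → Above h (concat (map (cycleOf σ) hs))
  above []         = tt
  above (h<h′ ∷ _) = h<h′

standardCycleForm-blocks : ∀ {n} (σ : Vec (Fin n) n) → Blocks (standardCycleForm σ)
standardCycleForm-blocks {n} σ =
  cycleOf-blocks σ (cycleMaxima-sorted σ) (All.all-filter (isCycleMax? σ) (allFin n))

cycleOf-≡⇒≡ : ∀ {n} (σ τ : Vec (Fin n) n) {M M′} → cycleOf σ M ≡ cycleOf τ M′ → M ≡ M′
cycleOf-≡⇒≡ {suc n} σ τ = List.∷-injectiveˡ

θ-injective : ∀ {n} (σ τ : Vec (Fin n) n) → IsPerm σ → IsPerm τ → θ σ ≡ θ τ → σ ≡ τ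
θ-injective σ τ σ-perm τ-perm θσ≡θτ = lookup-ext agree
  where
  same-form : standardCycleForm σ ≡ standardCycleForm τ
  same-form = concat-injective (standardCycleForm-blocks σ) (standardCycleForm-blocks τ) θσ≡θτ
  agree : ∀ z → lookup σ z ≡ lookup τ z
  agree z with Orbits.cycleOf-leader σ σ-perm z
  ... | M , M-max , z∈
    with ∈-map⁻ (cycleOf τ) (subst (cycleOf σ M ∈_) same-form (∈-map⁺ (cycleOf σ) (∈-cycleMaxima⁺ σ M-max)))
  ...   | M′ , _ , cσM≡cτM′ = cycleOf-determines σ τ σ-perm τ-perm
                                (trans cσM≡cτM′ (cong (cycleOf τ) (sym (cycleOf-≡⇒≡ σ τ cσM≡cτM′)))) z∈

fill : ∀ {n} → List A → Vec A n → Vec A n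
fill []       v       = v
fill (x ∷ xs) []      = []
fill (x ∷ xs) (_ ∷ v) = x ∷ fill xs v

toList-fill : ∀ {n} (xs : List A) (v : Vec A n) → length xs ≡ n → toList (fill xs v) ≡ xs
toList-fill []       []      _ = refl
toList-fill (x ∷ xs) (_ ∷ v) e = cong (x ∷_) (toList-fill xs v (ℕ.suc-injective e))

θᵥ : ∀ {n} → Vec (Fin n) n → Vec (Fin n) n
θᵥ σ = fill (θ σ) σ

module _ {n} (σ : Vec (Fin n) n) (σ-perm : IsPerm σ) where

  toList-θᵥ : toList (θᵥ σ) ≡ θ σ
  toList-θᵥ = toList-fill (θ σ) σ (Orbits.length-θ σ σ-perm)

  θᵥ-perm : IsPerm (θᵥ σ)
  θᵥ-perm = Unique⇒lookup-injective (θᵥ σ) (subst Unique (sym toList-θᵥ) (Orbits.θ-unique σ σ-perm))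

  θᵥ-injective : ∀ {τ} → IsPerm τ → θᵥ σ ≡ θᵥ τ → σ ≡ τ
  θᵥ-injective {τ} τ-perm e = θ-injective σ τ σ-perm τ-perm
    (trans (sym toList-θᵥ) (trans (cong toList e) (toList-fill (θ τ) τ (Orbits.length-θ τ τ-perm))))

  hatMaps-θᵥ⁺ : ∀ {x y} → lookup σ x ≡ y → HatMaps (θᵥ σ) x y
  hatMaps-θᵥ⁺ σx≡y = σ , σ-perm , sym toList-θᵥ , σx≡y

  hatMaps-θᵥ⁻ : ∀ {x y} → HatMaps (θᵥ σ) x y → lookup σ x ≡ y
  hatMaps-θᵥ⁻ {x} (τ , τ-perm , θτ≡ , τx≡y) =
    trans (cong (λ ρ → lookup ρ x) (θ-injective σ τ σ-perm τ-perm (trans (sym toList-θᵥ) (sym θτ≡)))) τx≡y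

-- Occurrences of (21; 2 → 2)

module _ {n : ℕ} where

  Occurrence : Vec (Fin n) n → Set
  Occurrence π = ∃₂ λ u v → v Fin.< u × Precedes (toList π) u v × HatMaps π u u

  contains⇒occurrence : ∀ {π} → Contains π pat21-2→2 → Occurrence π
  contains⇒occurrence {π} (x₀ ∷ x₁ ∷ [] , x-incr , t₀ ∷ t₁ ∷ [] , t-incr , πt≡x , x₁↦x₁ ∷ []) =
    x₁ , x₀ , x-incr zero (suc zero) (s≤s z≤n) ,
    subst₂ (Precedes (toList π)) (πt≡x zero) (πt≡x (suc zero))
           (lookup-precedes π (t-incr zero (suc zero) (s≤s z≤n))) ,
    x₁↦x₁

  occurrence⇒contains : ∀ {π} → Occurrence π → Contains π pat21-2→2
  occurrence⇒contains {π} (u , v , v<u , u≺v , u↦u) with precedes⇒lookup π u≺v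
  ... | p , q , p<q , πp≡u , πq≡v = v ∷ u ∷ [] , increasing v<u , p ∷ q ∷ [] , increasing p<q , πt≡x , u↦u ∷ []
    where
    increasing : ∀ {x y : Fin n} → x Fin.< y → StrictlyIncreasing (x ∷ y ∷ [])
    increasing x<y zero       (suc zero) _         = x<y
    increasing x<y (suc zero) (suc zero) (s≤s ())
    πt≡x : ∀ i → lookup π (lookup (p ∷ q ∷ []) i) ≡ lookup (v ∷ u ∷ []) (lookup (suc zero ∷ zero ∷ []) i)
    πt≡x zero       = πp≡u
    πt≡x (suc zero) = πq≡v

module _ {n} (σ : Vec (Fin n) n) (σ-perm : IsPerm σ) {u : Fin n} (σu≡u : lookup σ u ≡ u) where

  private
    open Orbits σ σ-perm

    u-max : IsCycleMax σ u
    u-max = subst (All (Fin._≤ u)) (sym (cycleOf-fixed σ σu≡u)) (Fin.≤-refl ∷ [])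

    split : ∃₂ λ hs₁ hs₂ → cycleMaxima σ ≡ hs₁ ++ u ∷ hs₂
    split = ∈-∃++ (∈-cycleMaxima⁺ σ u-max)

    hs₁ = proj₁ split
    hs₂ = proj₁ (proj₂ split)
    maxima≡ = proj₂ (proj₂ split)

    below×above : All (Fin._< u) hs₁ × All (u Fin.<_) hs₂
    below×above = AllPairs-pivot hs₁ (subst (AllPairs Fin._<_) maxima≡ (cycleMaxima-sorted σ))

    before after : List (Fin n)
    before = concat (map (cycleOf σ) hs₁)
    after  = concat (map (cycleOf σ) hs₂)

    θ≡ : θ σ ≡ before ++ u ∷ after
    θ≡ = begin
      concat (map (cycleOf σ) (cycleMaxima σ))
        ≡⟨ cong (concat ∘ map (cycleOf σ)) maxima≡ ⟩
      concat (map (cycleOf σ) (hs₁ ++ u ∷ hs₂))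
        ≡⟨ cong concat (List.map-++ (cycleOf σ) hs₁ (u ∷ hs₂)) ⟩
      concat (map (cycleOf σ) hs₁ ++ map (cycleOf σ) (u ∷ hs₂))
        ≡⟨ List.concat-++ (map (cycleOf σ) hs₁) _ ⟨
      before ++ cycleOf σ u ++ after
        ≡⟨ cong (λ c → before ++ c ++ after) (cycleOf-fixed σ σu≡u) ⟩
      before ++ u ∷ after
        ∎
      where open ≡-Reasoning

    ∈-after⁻ : ∀ {z} → z ∈ after → ∃ λ M → M ∈ hs₂ × z ∈ cycleOf σ M
    ∈-after⁻ z∈ with ∈-concat⁻′ (map (cycleOf σ) hs₂) z∈
    ... | _ , z∈c , c∈ with ∈-map⁻ (cycleOf σ) c∈
    ...   | M , M∈hs₂ , refl = M , M∈hs₂ , z∈c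

    ∈-hs₂⁻ : ∀ {M} → M ∈ hs₂ → IsCycleMax σ M × u Fin.< M
    ∈-hs₂⁻ {M} M∈hs₂ = ∈-cycleMaxima⁻ σ (subst (M ∈_) (sym maxima≡) (∈-++⁺ʳ hs₁ (there M∈hs₂))) ,
                       All.lookup (proj₂ below×above) M∈hs₂

    ∈-hs₂⁺ : ∀ {M} → IsCycleMax σ M → u Fin.< M → M ∈ hs₂
    ∈-hs₂⁺ {M} M-max u<M with ∈-++⁻ hs₁ (subst (M ∈_) maxima≡ (∈-cycleMaxima⁺ σ M-max))
    ... | inj₁ M∈hs₁       = contradiction (All.lookup (proj₁ below×above) M∈hs₁) (ℕ.<⇒≯ u<M)
    ... | inj₂ (here refl) = contradiction u<M (ℕ.<-irrefl refl)
    ... | inj₂ (there M∈)  = M∈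

  precedes-θ⁻ : ∀ {z} → Precedes (θ σ) u z → ∃ λ M → IsCycleMax σ M × u Fin.< M × z ∈ cycleOf σ M
  precedes-θ⁻ {z} u≺z
    with ∈-after⁻ (precedes-unique before (subst Unique θ≡ θ-unique) (subst (λ xs → Precedes xs u z) θ≡ u≺z))
  ... | M , M∈hs₂ , z∈ = M , proj₁ (∈-hs₂⁻ M∈hs₂) , proj₂ (∈-hs₂⁻ M∈hs₂) , z∈

  precedes-θ⁺ : ∀ {M z} → IsCycleMax σ M → u Fin.< M → z ∈ cycleOf σ M → Precedes (θ σ) u z
  precedes-θ⁺ M-max u<M z∈ = before , after , θ≡ , ∈-concat⁺′ z∈ (∈-map⁺ (cycleOf σ) (∈-hs₂⁺ M-max u<M))

SplitsAtFixedPoints : ∀ {n} → Vec (Fin n) n → Set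
SplitsAtFixedPoints σ = ∀ u → lookup σ u ≡ u → ∀ y → y Fin.< u → lookup σ y Fin.< u

splitsAtFixedPoints? : ∀ {n} (σ : Vec (Fin n) n) → Dec (SplitsAtFixedPoints σ)
splitsAtFixedPoints? σ =
  Fin.all? λ u → (lookup σ u Fin.≟ u) →-dec Fin.all? λ y → (y Fin.<? u) →-dec (lookup σ y Fin.<? u)

iterate-below-fixed : ∀ {n} (σ : Vec (Fin n) n) → SplitsAtFixedPoints σ → ∀ {u v} → lookup σ u ≡ u → v Fin.< u →
                      ∀ i → iterate (lookup σ) i v Fin.< u
iterate-below-fixed σ splits         σu≡u v<u zero    = v<u
iterate-below-fixed σ splits {u} {v} σu≡u v<u (suc i) =
  subst (Fin._< u) (sym (iterate-suc (lookup σ) i v)) (splits u σu≡u _ (iterate-below-fixed σ splits σu≡u v<u i))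

module _ {n} (σ : Vec (Fin n) n) (σ-perm : IsPerm σ) where

  open Orbits σ σ-perm

  splits⇒avoids : SplitsAtFixedPoints σ → Avoids (θᵥ σ) pat21-2→2
  splits⇒avoids splits = no-occurrence ∘ contains⇒occurrence
    where
    no-occurrence : ¬ Occurrence (θᵥ σ)
    no-occurrence (u , v , v<u , u≺v , u↦u) = no-leader-above (precedes-θ⁻ σ σ-perm σu≡u u≺v′)
      where
      σu≡u : lookup σ u ≡ u
      σu≡u = hatMaps-θᵥ⁻ σ σ-perm u↦u
      u≺v′ : Precedes (θ σ) u v
      u≺v′ = subst (λ xs → Precedes xs u v) (toList-θᵥ σ σ-perm) u≺v
      no-leader-above : (∃ λ M → IsCycleMax σ M × u Fin.< M × v ∈ cycleOf σ M) → ⊥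
      no-leader-above (M , _ , u<M , v∈) with ∈-cycleOf⁻ v (cycleOf-sym v∈)
      ... | i , _ , fⁱv≡M = ℕ.<-asym u<M M<u
        where
        M<u : M Fin.< u
        M<u = subst (Fin._< u) fⁱv≡M (iterate-below-fixed σ splits σu≡u v<u i)

  avoids⇒splits : Avoids (θᵥ σ) pat21-2→2 → SplitsAtFixedPoints σ
  avoids⇒splits avoids u σu≡u y y<u with lookup σ y Fin.<? u
  ... | yes σy<u = σy<u
  ... | no  σy≮u with cycleOf-leader y
  ...   | M , M-max , y∈ = contradiction (occurrence⇒contains occurrence) avoids
    where
    u<σy : u Fin.< lookup σ y
    u<σy = Fin.≤∧≢⇒< (ℕ.≮⇒≥ σy≮u) λ u≡σy → Fin.<⇒≢ y<u (σ-perm y u (trans (sym u≡σy) (sym σu≡u)))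
    occurrence : Occurrence (θᵥ σ)
    occurrence = u , y , y<u ,
      subst (λ xs → Precedes xs u y) (sym (toList-θᵥ σ σ-perm))
        (precedes-θ⁺ σ σ-perm σu≡u M-max (ℕ.<-≤-trans u<σy (All.lookup M-max (cycleOf-closed y∈))) y∈) ,
      hatMaps-θᵥ⁺ σ σ-perm σu≡u

-- Direct sums of permutations

injective⇒surjective : ∀ {m} (f : Fin m → Fin m) → (∀ {a b} → f a ≡ f b → a ≡ b) → ∀ y → ∃ λ a → f a ≡ y
injective⇒surjective {suc m} f f-inj y with Fin.any? (λ a → f a Fin.≟ y)
... | yes hit = hit
... | no miss with Fin.pigeonhole (ℕ.n<1+n m) (λ a → punchOut {i = y} (miss ∘ (a ,_) ∘ sym))
...   | a , b , a<b , e =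
  contradiction (f-inj (Fin.punchOut-injective (miss ∘ (a ,_) ∘ sym) (miss ∘ (b ,_) ∘ sym) e)) (Fin.<⇒≢ a<b)

module _ {j k : ℕ} where

  data Side : Fin (j + k) → Set where
    left  : (a : Fin j) → Side (a ↑ˡ k)
    right : (b : Fin k) → Side (j ↑ʳ b)

  ↑ˡ-<-↑ʳ : ∀ (a : Fin j) (b : Fin k) → a ↑ˡ k Fin.< j ↑ʳ b
  ↑ˡ-<-↑ʳ a b = subst₂ _<_ (sym (Fin.toℕ-↑ˡ a k)) (sym (Fin.toℕ-↑ʳ j b))
                          (ℕ.<-≤-trans (Fin.toℕ<n a) (ℕ.m≤m+n j (toℕ b)))

  ↑ˡ-<⁺ : ∀ {a a′ : Fin j} → a Fin.< a′ → a ↑ˡ k Fin.< a′ ↑ˡ k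
  ↑ˡ-<⁺ {a} {a′} = subst₂ _<_ (sym (Fin.toℕ-↑ˡ a k)) (sym (Fin.toℕ-↑ˡ a′ k))

  ↑ˡ-<⁻ : ∀ {a a′ : Fin j} → a ↑ˡ k Fin.< a′ ↑ˡ k → a Fin.< a′
  ↑ˡ-<⁻ {a} {a′} = subst₂ _<_ (Fin.toℕ-↑ˡ a k) (Fin.toℕ-↑ˡ a′ k)

  ↑ʳ-<⁺ : ∀ {b b′ : Fin k} → b Fin.< b′ → j ↑ʳ b Fin.< j ↑ʳ b′
  ↑ʳ-<⁺ {b} {b′} b<b′ = subst₂ _<_ (sym (Fin.toℕ-↑ʳ j b)) (sym (Fin.toℕ-↑ʳ j b′)) (ℕ.+-monoʳ-< j b<b′)

  ↑ʳ-<⁻ : ∀ {b b′ : Fin k} → j ↑ʳ b Fin.< j ↑ʳ b′ → b Fin.< b′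
  ↑ʳ-<⁻ {b} {b′} lt = ℕ.+-cancelˡ-< j _ _ (subst₂ _<_ (Fin.toℕ-↑ʳ j b) (Fin.toℕ-↑ʳ j b′) lt)

side : ∀ j {k} (i : Fin (j + k)) → Side {j} {k} i
side zero    i       = right i
side (suc j) zero    = left zero
side (suc j) (suc i) with side j i
... | left a  = left (suc a)
... | right b = right b

module _ {j k : ℕ} where

  _⊕_ : Vec (Fin j) j → Vec (Fin k) k → Vec (Fin (j + k)) (j + k)
  τ ⊕ ρ = Vec.map (_↑ˡ k) τ Vec.++ Vec.map (j ↑ʳ_) ρ

  lookup-⊕-↑ˡ : ∀ τ ρ a → lookup (τ ⊕ ρ) (a ↑ˡ k) ≡ lookup τ a ↑ˡ k
  lookup-⊕-↑ˡ τ ρ a = trans (Vec.lookup-++ˡ (Vec.map (_↑ˡ k) τ) _ a) (Vec.lookup-map a (_↑ˡ k) τ)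

  lookup-⊕-↑ʳ : ∀ τ ρ b → lookup (τ ⊕ ρ) (j ↑ʳ b) ≡ j ↑ʳ lookup ρ b
  lookup-⊕-↑ʳ τ ρ b = trans (Vec.lookup-++ʳ (Vec.map (_↑ˡ k) τ) _ b) (Vec.lookup-map b (j ↑ʳ_) ρ)

  ⊕-fixedˡ⁻ : ∀ τ ρ {a} → lookup (τ ⊕ ρ) (a ↑ˡ k) ≡ a ↑ˡ k → lookup τ a ≡ a
  ⊕-fixedˡ⁻ τ ρ {a} e = Fin.↑ˡ-injective k _ a (trans (sym (lookup-⊕-↑ˡ τ ρ a)) e)

  ⊕-fixedʳ⁻ : ∀ τ ρ {b} → lookup (τ ⊕ ρ) (j ↑ʳ b) ≡ j ↑ʳ b → lookup ρ b ≡ b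
  ⊕-fixedʳ⁻ τ ρ {b} e = Fin.↑ʳ-injective j _ b (trans (sym (lookup-⊕-↑ʳ τ ρ b)) e)

  ⊕-perm : ∀ τ ρ → IsPerm τ → IsPerm ρ → IsPerm (τ ⊕ ρ)
  ⊕-perm τ ρ τ-perm ρ-perm i i′ = go (side j i) (side j i′)
    where
    go : ∀ {i i′} → Side i → Side i′ → lookup (τ ⊕ ρ) i ≡ lookup (τ ⊕ ρ) i′ → i ≡ i′
    go (left a)  (left a′)  e = cong (_↑ˡ k) (τ-perm a a′ (Fin.↑ˡ-injective k _ _
                                  (trans (sym (lookup-⊕-↑ˡ τ ρ a)) (trans e (lookup-⊕-↑ˡ τ ρ a′)))))
    go (right b) (right b′) e = cong (j ↑ʳ_) (ρ-perm b b′ (Fin.↑ʳ-injective j _ _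
                                  (trans (sym (lookup-⊕-↑ʳ τ ρ b)) (trans e (lookup-⊕-↑ʳ τ ρ b′)))))
    go (left a)  (right b′) e = contradiction (trans (sym (lookup-⊕-↑ˡ τ ρ a)) (trans e (lookup-⊕-↑ʳ τ ρ b′)))
                                              (Fin.<⇒≢ (↑ˡ-<-↑ʳ _ _))
    go (right b) (left a′)  e = contradiction (trans (sym (lookup-⊕-↑ˡ τ ρ a′)) (trans (sym e) (lookup-⊕-↑ʳ τ ρ b)))
                                              (Fin.<⇒≢ (↑ˡ-<-↑ʳ _ _))

  ⊕-splits : ∀ τ ρ → SplitsAtFixedPoints τ → SplitsAtFixedPoints ρ → SplitsAtFixedPoints (τ ⊕ ρ)
  ⊕-splits τ ρ τ-splits ρ-splits u σu≡u y y<u = go (side j u) (side j y) σu≡u y<u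
    where
    go : ∀ {u y} → Side u → Side y → lookup (τ ⊕ ρ) u ≡ u → y Fin.< u → lookup (τ ⊕ ρ) y Fin.< u
    go (left a)  (left a′)  σu≡u y<u = subst (Fin._< a ↑ˡ k) (sym (lookup-⊕-↑ˡ τ ρ a′))
                                         (↑ˡ-<⁺ (τ-splits a (⊕-fixedˡ⁻ τ ρ σu≡u) a′ (↑ˡ-<⁻ y<u)))
    go (left a)  (right b′) σu≡u y<u = contradiction (↑ˡ-<-↑ʳ a b′) (ℕ.<-asym y<u)
    go (right b) (left a′)  σu≡u y<u = subst (Fin._< j ↑ʳ b) (sym (lookup-⊕-↑ˡ τ ρ a′)) (↑ˡ-<-↑ʳ _ b)
    go (right b) (right b′) σu≡u y<u = subst (Fin._< j ↑ʳ b) (sym (lookup-⊕-↑ʳ τ ρ b′))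
                                         (↑ʳ-<⁺ (ρ-splits b (⊕-fixedʳ⁻ τ ρ σu≡u) b′ (↑ʳ-<⁻ y<u)))

  ⊕-splits⁻ˡ : ∀ τ ρ → SplitsAtFixedPoints (τ ⊕ ρ) → SplitsAtFixedPoints τ
  ⊕-splits⁻ˡ τ ρ σ-splits a τa≡a a′ a′<a = ↑ˡ-<⁻ (subst (Fin._< a ↑ˡ k) (lookup-⊕-↑ˡ τ ρ a′)
    (σ-splits (a ↑ˡ k) (trans (lookup-⊕-↑ˡ τ ρ a) (cong (_↑ˡ k) τa≡a)) (a′ ↑ˡ k) (↑ˡ-<⁺ a′<a)))

  restrictˡ : Vec (Fin (j + k)) (j + k) → Vec (Fin j) j
  restrictˡ σ = tabulate λ a → fromInj₁ (const a) (splitAt j (lookup σ (a ↑ˡ k)))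

  restrictʳ : Vec (Fin (j + k)) (j + k) → Vec (Fin k) k
  restrictʳ σ = tabulate λ b → fromInj₂ (const b) (splitAt j (lookup σ (j ↑ʳ b)))

  lookup-restrictˡ : ∀ σ {a a′} → lookup σ (a ↑ˡ k) ≡ a′ ↑ˡ k → lookup (restrictˡ σ) a ≡ a′
  lookup-restrictˡ σ {a} {a′} e = begin
    lookup (restrictˡ σ) a                             ≡⟨ Vec.lookup∘tabulate _ a ⟩
    fromInj₁ (const a) (splitAt j (lookup σ (a ↑ˡ k))) ≡⟨ cong (fromInj₁ (const a) ∘ splitAt j) e ⟩
    fromInj₁ (const a) (splitAt j (a′ ↑ˡ k))           ≡⟨ cong (fromInj₁ (const a)) (Fin.splitAt-↑ˡ j a′ k) ⟩
    a′                                                 ∎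
    where open ≡-Reasoning

  lookup-restrictʳ : ∀ σ {b b′} → lookup σ (j ↑ʳ b) ≡ j ↑ʳ b′ → lookup (restrictʳ σ) b ≡ b′
  lookup-restrictʳ σ {b} {b′} e = begin
    lookup (restrictʳ σ) b                             ≡⟨ Vec.lookup∘tabulate _ b ⟩
    fromInj₂ (const b) (splitAt j (lookup σ (j ↑ʳ b))) ≡⟨ cong (fromInj₂ (const b) ∘ splitAt j) e ⟩
    fromInj₂ (const b) (splitAt j (j ↑ʳ b′))           ≡⟨ cong (fromInj₂ (const b)) (Fin.splitAt-↑ʳ j k b′) ⟩
    b′                                                 ∎
    where open ≡-Reasoning

  restrictˡ-⊕ : ∀ τ ρ → restrictˡ (τ ⊕ ρ) ≡ τ
  restrictˡ-⊕ τ ρ = lookup-ext λ a → lookup-restrictˡ (τ ⊕ ρ) (lookup-⊕-↑ˡ τ ρ a)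

  restrictʳ-⊕ : ∀ τ ρ → restrictʳ (τ ⊕ ρ) ≡ ρ
  restrictʳ-⊕ τ ρ = lookup-ext λ b → lookup-restrictʳ (τ ⊕ ρ) (lookup-⊕-↑ʳ τ ρ b)

  LowerBlockClosed : Vec (Fin (j + k)) (j + k) → Set
  LowerBlockClosed σ = ∀ a → ∃ λ a′ → lookup σ (a ↑ˡ k) ≡ a′ ↑ˡ k

  module _ (σ : Vec (Fin (j + k)) (j + k)) (σ-perm : IsPerm σ) (closed : LowerBlockClosed σ) where

    private
      lower : ∀ a → lookup σ (a ↑ˡ k) ≡ lookup (restrictˡ σ) a ↑ˡ k
      lower a with closed a
      ... | a′ , e = trans e (cong (_↑ˡ k) (sym (lookup-restrictˡ σ e)))

    restrictˡ-perm : IsPerm (restrictˡ σ)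
    restrictˡ-perm a a′ e =
      Fin.↑ˡ-injective k a a′ (σ-perm _ _ (trans (lower a) (trans (cong (_↑ˡ k) e) (sym (lower a′)))))

    private
      -- The lower block is already filled by the images of the lower block, as restrictˡ σ is onto.
      upper : ∀ b → lookup σ (j ↑ʳ b) ≡ j ↑ʳ lookup (restrictʳ σ) b
      upper b = go (side j (lookup σ (j ↑ʳ b))) refl
        where
        go : ∀ {v} → Side v → lookup σ (j ↑ʳ b) ≡ v → lookup σ (j ↑ʳ b) ≡ j ↑ʳ lookup (restrictʳ σ) b
        go (left a′) e with injective⇒surjective (lookup (restrictˡ σ)) (restrictˡ-perm _ _) a′
        ... | a , τa≡a′ = contradiction (σ-perm _ _ (trans (lower a) (trans (cong (_↑ˡ k) τa≡a′) (sym e))))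
                                        (Fin.<⇒≢ (↑ˡ-<-↑ʳ a b))
        go (right b′) e = trans e (cong (j ↑ʳ_) (sym (lookup-restrictʳ σ e)))

    restrictʳ-perm : IsPerm (restrictʳ σ)
    restrictʳ-perm b b′ e =
      Fin.↑ʳ-injective j b b′ (σ-perm _ _ (trans (upper b) (trans (cong (j ↑ʳ_) e) (sym (upper b′)))))

    ⊕-restrict : restrictˡ σ ⊕ restrictʳ σ ≡ σ
    ⊕-restrict = lookup-ext λ i → go (side j i)
      where
      go : ∀ {i} → Side i → lookup (restrictˡ σ ⊕ restrictʳ σ) i ≡ lookup σ i
      go (left a)  = trans (lookup-⊕-↑ˡ (restrictˡ σ) (restrictʳ σ) a) (sym (lower a))
      go (right b) = trans (lookup-⊕-↑ʳ (restrictˡ σ) (restrictʳ σ) b) (sym (upper b))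

-- The largest fixed point

fixedPointFree? : ∀ {n} (σ : Vec (Fin n) n) → Dec (FixedPointFree σ)
fixedPointFree? σ = Fin.all? λ i → ¬? (lookup σ i Fin.≟ i)

fixedPointFree⇒splits : ∀ {n} (σ : Vec (Fin n) n) → FixedPointFree σ → SplitsAtFixedPoints σ
fixedPointFree⇒splits σ σ-fpf u σu≡u = contradiction σu≡u (σ-fpf u)

module _ {n} (σ : Vec (Fin n) n) where

  fixedPoints : List (Fin n)
  fixedPoints = filter (λ i → lookup σ i Fin.≟ i) (allFin n)

  -- Shifted by one: 0 encodes the absence of fixed points, and the values are the summation indices i.
  sucMaxFixedPoint : ℕ
  sucMaxFixedPoint = Extremaℕ.max 0 (map (ℕ.suc ∘ toℕ) fixedPoints)

  TopFixedPoint : Fin n → Set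
  TopFixedPoint x = lookup σ x ≡ x × (∀ y → lookup σ y ≡ y → y Fin.≤ x)

  private
    ∈-fixedPoints⁺ : ∀ {y} → lookup σ y ≡ y → suc (toℕ y) ∈ map (ℕ.suc ∘ toℕ) fixedPoints
    ∈-fixedPoints⁺ σy≡y = ∈-map⁺ (ℕ.suc ∘ toℕ) (∈-filter⁺ (λ i → lookup σ i Fin.≟ i) (∈-allFin _) σy≡y)

    ∈-fixedPoints⁻ : ∀ {y} → y ∈ fixedPoints → lookup σ y ≡ y
    ∈-fixedPoints⁻ = proj₂ ∘ ∈-filter⁻ (λ i → lookup σ i Fin.≟ i) {xs = allFin n}

    below-sucMax : ∀ {y} → lookup σ y ≡ y → suc (toℕ y) ≤ sucMaxFixedPoint
    below-sucMax σy≡y = All.lookup (Extremaℕ.xs≤max 0 _) (∈-fixedPoints⁺ σy≡y)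

    all-fixedPoints : ∀ {P : ℕ → Set} → (∀ {y} → lookup σ y ≡ y → P (suc (toℕ y))) →
                      All P (map (ℕ.suc ∘ toℕ) fixedPoints)
    all-fixedPoints P-fixed = All.map⁺ (All.tabulate (P-fixed ∘ ∈-fixedPoints⁻))

  sucMaxFixedPoint≤n : sucMaxFixedPoint ≤ n
  sucMaxFixedPoint≤n = Extremaℕ.max≤v⁺ z≤n (all-fixedPoints {P = _≤ n} λ {y} _ → Fin.toℕ<n y)

  sucMaxFixedPoint≡0⁺ : FixedPointFree σ → sucMaxFixedPoint ≡ 0
  sucMaxFixedPoint≡0⁺ σ-fpf = cong (Extremaℕ.max 0 ∘ map (ℕ.suc ∘ toℕ))
    (List.filter-none (λ i → lookup σ i Fin.≟ i) {xs = allFin n} (All.tabulate λ _ → σ-fpf _))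

  sucMaxFixedPoint≡0⁻ : sucMaxFixedPoint ≡ 0 → FixedPointFree σ
  sucMaxFixedPoint≡0⁻ max≡0 y σy≡y = contradiction (subst (suc (toℕ y) ≤_) max≡0 (below-sucMax σy≡y)) λ ()

  sucMaxFixedPoint≡suc⁺ : ∀ {x} → TopFixedPoint x → sucMaxFixedPoint ≡ suc (toℕ x)
  sucMaxFixedPoint≡suc⁺ {x} (σx≡x , top) =
    Extremaℕ.max≈v⁺ (∈-fixedPoints⁺ σx≡x) (all-fixedPoints {P = _≤ suc (toℕ x)} λ σy≡y → s≤s (top _ σy≡y)) z≤n

  sucMaxFixedPoint≡suc⁻ : ∀ {i} → sucMaxFixedPoint ≡ suc i → ∃ λ x → toℕ x ≡ i × TopFixedPoint x
  sucMaxFixedPoint≡suc⁻ max≡1+i with Extremaℕ.argmax-sel id 0 (map (ℕ.suc ∘ toℕ) fixedPoints)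
  ... | inj₁ max≡0 = contradiction (trans (sym max≡0) max≡1+i) λ ()
  ... | inj₂ max∈ with ∈-map⁻ (ℕ.suc ∘ toℕ) max∈
  ...   | x , x∈ , max≡1+x = x , ℕ.suc-injective (trans (sym max≡1+x) max≡1+i) , ∈-fixedPoints⁻ x∈ ,
          λ y σy≡y → ℕ.≤-pred (subst (suc (toℕ y) ≤_) max≡1+x (below-sucMax σy≡y))

-- Permutations that split at their fixed points

ι : Vec (Fin 1) 1
ι = zero ∷ []

ι-unique : (v : Vec (Fin 1) 1) → v ≡ ι
ι-unique (zero ∷ []) = refl

module _ {j r : ℕ} where

  glue : Vec (Fin j) j → Vec (Fin r) r → Vec (Fin (j + suc r)) (j + suc r)
  glue τ ρ = τ ⊕ (ι ⊕ ρ)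

  unglue : Vec (Fin (j + suc r)) (j + suc r) → Vec (Fin j) j × Vec (Fin r) r
  unglue σ = restrictˡ σ , restrictʳ {1} (restrictʳ σ)

  unglue-glue : ∀ τ ρ → unglue (glue τ ρ) ≡ (τ , ρ)
  unglue-glue τ ρ = cong₂ _,_ (restrictˡ-⊕ τ (ι ⊕ ρ))
                              (trans (cong (restrictʳ {1}) (restrictʳ-⊕ τ (ι ⊕ ρ))) (restrictʳ-⊕ ι ρ))

  glue-perm : ∀ τ ρ → IsPerm τ → IsPerm ρ → IsPerm (glue τ ρ)
  glue-perm τ ρ τ-perm ρ-perm = ⊕-perm τ (ι ⊕ ρ) τ-perm (⊕-perm ι ρ (λ { zero zero _ → refl }) ρ-perm)

  glue-splits : ∀ τ ρ → SplitsAtFixedPoints τ → FixedPointFree ρ → SplitsAtFixedPoints (glue τ ρ)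
  glue-splits τ ρ τ-splits ρ-fpf =
    ⊕-splits τ (ι ⊕ ρ) τ-splits (⊕-splits ι ρ (λ { zero _ zero () }) (fixedPointFree⇒splits ρ ρ-fpf))

  glue-top : ∀ τ {ρ} → FixedPointFree ρ → TopFixedPoint (glue τ ρ) (j ↑ʳ zero)
  glue-top τ {ρ} ρ-fpf = lookup-⊕-↑ʳ τ (ι ⊕ ρ) zero , λ y σy≡y → go (side j y) σy≡y
    where
    go : ∀ {y} → Side y → lookup (glue τ ρ) y ≡ y → y Fin.≤ j ↑ʳ zero
    go (left a)  _ = ℕ.<⇒≤ (↑ˡ-<-↑ʳ a zero)
    go (right b) σy≡y with side 1 b
    ... | left zero = Fin.≤-refl
    ... | right b′  = contradiction (⊕-fixedʳ⁻ ι ρ (⊕-fixedʳ⁻ τ (ι ⊕ ρ) σy≡y)) (ρ-fpf b′)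

  module Unglue (σ : Vec (Fin (j + suc r)) (j + suc r)) (σ-perm : IsPerm σ) (σ-splits : SplitsAtFixedPoints σ)
                (σ-top : TopFixedPoint σ (j ↑ʳ zero)) where

    private
      closed : LowerBlockClosed σ
      closed a = go (side j (lookup σ (a ↑ˡ suc r))) refl
        where
        below : lookup σ (a ↑ˡ suc r) Fin.< j ↑ʳ zero
        below = σ-splits (j ↑ʳ zero) (proj₁ σ-top) (a ↑ˡ suc r) (↑ˡ-<-↑ʳ a zero)
        go : ∀ {v} → Side v → lookup σ (a ↑ˡ suc r) ≡ v → ∃ λ a′ → lookup σ (a ↑ˡ suc r) ≡ a′ ↑ˡ suc r
        go (left a′) e = a′ , e
        go (right b) e = contradiction (↑ʳ-<⁻ {j = j} (subst (Fin._< j ↑ʳ zero) e below)) λ ()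

      σ′ : Vec (Fin (suc r)) (suc r)
      σ′ = restrictʳ σ

      σ′-perm : IsPerm σ′
      σ′-perm = restrictʳ-perm σ σ-perm closed

      σ′-closed : LowerBlockClosed {1} σ′
      σ′-closed zero = zero , lookup-restrictʳ σ (proj₁ σ-top)

    glue-unglue : uncurry glue (unglue σ) ≡ σ
    glue-unglue = begin
      restrictˡ σ ⊕ (ι ⊕ restrictʳ {1} σ′)
        ≡⟨ cong (λ v → restrictˡ σ ⊕ (v ⊕ restrictʳ {1} σ′)) (ι-unique _) ⟨
      restrictˡ σ ⊕ (restrictˡ {1} σ′ ⊕ restrictʳ {1} σ′)
        ≡⟨ cong (restrictˡ σ ⊕_) (⊕-restrict σ′ σ′-perm σ′-closed) ⟩
      restrictˡ σ ⊕ σ′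
        ≡⟨ ⊕-restrict σ σ-perm closed ⟩
      σ
        ∎
      where open ≡-Reasoning

    unglue₁-perm : IsPerm (proj₁ (unglue σ))
    unglue₁-perm = restrictˡ-perm σ σ-perm closed

    unglue₂-perm : IsPerm (proj₂ (unglue σ))
    unglue₂-perm = restrictʳ-perm σ′ σ′-perm σ′-closed

    unglue₁-splits : SplitsAtFixedPoints (proj₁ (unglue σ))
    unglue₁-splits =
      ⊕-splits⁻ˡ (restrictˡ σ) (ι ⊕ restrictʳ {1} σ′) (subst SplitsAtFixedPoints (sym glue-unglue) σ-splits)

    unglue₂-fixedPointFree : FixedPointFree (proj₂ (unglue σ))
    unglue₂-fixedPointFree b ρb≡b = ℕ.<⇒≱ (↑ʳ-<⁺ (s≤s z≤n)) (proj₂ σ-top (j ↑ʳ suc b) fixed)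
      where
      τ : Vec (Fin j) j
      τ = proj₁ (unglue σ)
      ρ : Vec (Fin r) r
      ρ = proj₂ (unglue σ)
      fixed : lookup σ (j ↑ʳ suc b) ≡ j ↑ʳ suc b
      fixed = begin
        lookup σ (j ↑ʳ suc b)          ≡⟨ cong (λ v → lookup v (j ↑ʳ suc b)) glue-unglue ⟨
        lookup (glue τ ρ) (j ↑ʳ suc b) ≡⟨ lookup-⊕-↑ʳ τ (ι ⊕ ρ) (suc b) ⟩
        j ↑ʳ lookup (ι ⊕ ρ) (suc b)    ≡⟨ cong (j ↑ʳ_) (lookup-⊕-↑ʳ ι ρ b) ⟩
        j ↑ʳ suc (lookup ρ b)          ≡⟨ cong (λ c → j ↑ʳ suc c) ρb≡b ⟩
        j ↑ʳ suc b                     ∎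
        where open ≡-Reasoning

splitting : ∀ n → List (Vec (Fin n) n)
splitting n = filter splitsAtFixedPoints? (S n)

derangements : ∀ n → List (Vec (Fin n) n)
derangements n = filter fixedPointFree? (S n)

fibre : ∀ n → ℕ → List (Vec (Fin n) n)
fibre n i = filter (λ σ → sucMaxFixedPoint σ ℕ.≟ i) (splitting n)

fibre-unique : ∀ n i → Unique (fibre n i)
fibre-unique n i =
  Unique.filter⁺ (λ σ → sucMaxFixedPoint σ ℕ.≟ i) (Unique.filter⁺ splitsAtFixedPoints? (S-unique n))

∈-fibre⁻ : ∀ {n i σ} → σ ∈ fibre n i → IsPerm σ × SplitsAtFixedPoints σ × sucMaxFixedPoint σ ≡ i
∈-fibre⁻ {n} {i} σ∈ with ∈-filter⁻ (λ σ → sucMaxFixedPoint σ ℕ.≟ i) {xs = splitting n} σ∈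
... | σ∈′ , key≡i with ∈-filter⁻ splitsAtFixedPoints? {xs = S n} σ∈′
...   | σ∈S , σ-splits = ∈-S⁻ σ∈S , σ-splits , key≡i

∈-fibre⁺ : ∀ {n i σ} → IsPerm σ → SplitsAtFixedPoints σ → sucMaxFixedPoint σ ≡ i → σ ∈ fibre n i
∈-fibre⁺ {i = i} σ-perm σ-splits key≡i =
  ∈-filter⁺ (λ σ → sucMaxFixedPoint σ ℕ.≟ i) (∈-filter⁺ splitsAtFixedPoints? (∈-S⁺ σ-perm) σ-splits) key≡i

a≡length-splitting : ∀ n → a pat21-2→2 n ≡ length (splitting n)
a≡length-splitting n = sym (length-filter-transport splitsAtFixedPoints? (λ π → ¬? (contains? π pat21-2→2)) θᵥ
  (S-unique n)
  (λ {σ} σ∈ τ∈ → θᵥ-injective σ (∈-S⁻ σ∈) (∈-S⁻ τ∈))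
  (λ {σ} σ∈ → ∈-S⁺ (θᵥ-perm σ (∈-S⁻ σ∈)))
  (λ {σ} σ∈ → splits⇒avoids σ (∈-S⁻ σ∈))
  (λ {σ} σ∈ ¬splits avoids → ¬splits (avoids⇒splits σ (∈-S⁻ σ∈) avoids)))

length-fibre-zero : ∀ n → length (fibre n 0) ≡ d n
length-fibre-zero n = length-≡-inverses id id (fibre-unique n 0) (Unique.filter⁺ fixedPointFree? (S-unique n))
  to from (λ _ → refl) (λ _ → refl)
  where
  to : ∀ {σ} → σ ∈ fibre n 0 → σ ∈ derangements n
  to {σ} σ∈ with ∈-fibre⁻ σ∈
  ... | σ-perm , _ , key≡0 = ∈-filter⁺ fixedPointFree? (∈-S⁺ σ-perm) (sucMaxFixedPoint≡0⁻ σ key≡0)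
  from : ∀ {σ} → σ ∈ derangements n → σ ∈ fibre n 0
  from {σ} σ∈ with ∈-filter⁻ fixedPointFree? {xs = S n} σ∈
  ... | σ∈S , σ-fpf = ∈-fibre⁺ (∈-S⁻ σ∈S) (fixedPointFree⇒splits σ σ-fpf) (sucMaxFixedPoint≡0⁺ σ σ-fpf)

length-fibre-glue : ∀ j r → length (fibre (j + suc r) (suc j)) ≡ length (splitting j) * d r
length-fibre-glue j r = begin
  length (fibre (j + suc r) (suc j))
    ≡⟨ length-≡-inverses unglue (uncurry glue) (fibre-unique _ _) pairs-unique
                         unglue∈ glue∈ glue∘unglue unglue∘glue ⟩
  length pairs
    ≡⟨ length-cartesianProduct (splitting j) (derangements r) ⟩
  length (splitting j) * d r
    ∎
  where
  open ≡-Reasoning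
  pairs : List (Vec (Fin j) j × Vec (Fin r) r)
  pairs = cartesianProduct (splitting j) (derangements r)
  pairs-unique : Unique pairs
  pairs-unique = Unique.cartesianProduct⁺ (Unique.filter⁺ splitsAtFixedPoints? (S-unique j))
                                          (Unique.filter⁺ fixedPointFree? (S-unique r))
  toℕ-mid : toℕ (j ↑ʳ zero {r}) ≡ j
  toℕ-mid = trans (Fin.toℕ-↑ʳ j (zero {r})) (ℕ.+-identityʳ j)
  top : ∀ {σ} → σ ∈ fibre (j + suc r) (suc j) → TopFixedPoint σ (j ↑ʳ zero)
  top {σ} σ∈ with sucMaxFixedPoint≡suc⁻ σ (proj₂ (proj₂ (∈-fibre⁻ σ∈)))
  ... | x , toℕx≡j , x-top = subst (TopFixedPoint σ) (Fin.toℕ-injective (trans toℕx≡j (sym toℕ-mid))) x-top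
  glue∈ : ∀ {τρ} → τρ ∈ pairs → uncurry glue τρ ∈ fibre (j + suc r) (suc j)
  glue∈ {τ , ρ} τρ∈ with ∈-cartesianProduct⁻ (splitting j) (derangements r) τρ∈
  ... | τ∈ , ρ∈ with ∈-filter⁻ splitsAtFixedPoints? {xs = S j} τ∈ | ∈-filter⁻ fixedPointFree? {xs = S r} ρ∈
  ...   | τ∈S , τ-splits | ρ∈S , ρ-fpf =
    ∈-fibre⁺ (glue-perm τ ρ (∈-S⁻ τ∈S) (∈-S⁻ ρ∈S)) (glue-splits τ ρ τ-splits ρ-fpf)
             (trans (sucMaxFixedPoint≡suc⁺ (glue τ ρ) (glue-top τ ρ-fpf)) (cong suc toℕ-mid))
  unglue∈ : ∀ {σ} → σ ∈ fibre (j + suc r) (suc j) → unglue σ ∈ pairs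
  unglue∈ {σ} σ∈ = ∈-cartesianProduct⁺ (∈-filter⁺ splitsAtFixedPoints? (∈-S⁺ unglue₁-perm) unglue₁-splits)
                                       (∈-filter⁺ fixedPointFree? (∈-S⁺ unglue₂-perm) unglue₂-fixedPointFree)
    where open Unglue σ (proj₁ (∈-fibre⁻ σ∈)) (proj₁ (proj₂ (∈-fibre⁻ σ∈))) (top σ∈)
  glue∘unglue : ∀ {σ} → σ ∈ fibre (j + suc r) (suc j) → uncurry glue (unglue σ) ≡ σ
  glue∘unglue {σ} σ∈ = Unglue.glue-unglue σ (proj₁ (∈-fibre⁻ σ∈)) (proj₁ (proj₂ (∈-fibre⁻ σ∈))) (top σ∈)
  unglue∘glue : ∀ {τρ} → τρ ∈ pairs → unglue (uncurry glue τρ) ≡ τρ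
  unglue∘glue {τ , ρ} _ = unglue-glue τ ρ

length-fibre-suc : ∀ n {j} → j < n → length (fibre n (suc j)) ≡ d (n ∸ suc j) * a pat21-2→2 j
length-fibre-suc n {j} j<n = begin
  length (fibre n (suc j))           ≡⟨ cong (λ N → length (fibre N (suc j))) n≡j+1+r ⟨
  length (fibre (j + suc r) (suc j)) ≡⟨ length-fibre-glue j r ⟩
  length (splitting j) * d r         ≡⟨ cong (_* d r) (a≡length-splitting j) ⟨
  a pat21-2→2 j * d r                ≡⟨ ℕ.*-comm (a pat21-2→2 j) (d r) ⟩
  d r * a pat21-2→2 j                ∎
  where
  open ≡-Reasoning
  r = n ∸ suc j
  n≡j+1+r : j + suc r ≡ n
  n≡j+1+r = trans (ℕ.+-suc j r) (ℕ.m+[n∸m]≡n j<n)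

theorem4p2 : (n : ℕ) → 1 ≤ n →
    a pat21-2→2 n ≡
      d n + sum (map (λ i → d (n ∸ i) * a pat21-2→2 (i ∸ 1)) (applyUpTo suc n))
theorem4p2 n _ = begin
  a pat21-2→2 n
    ≡⟨ a≡length-splitting n ⟩
  length (splitting n)
    ≡⟨ length-≡-sum-fibreSizes sucMaxFixedPoint (splitting n) (upTo (suc n)) (Unique.upTo⁺ (suc n))
         (λ {σ} _ → ∈-upTo⁺ (s≤s (sucMaxFixedPoint≤n σ))) ⟩
  sum (fibreSizes sucMaxFixedPoint (splitting n) (upTo (suc n)))
    ≡⟨ cong₂ _+_ (length-fibre-zero n)
                 (cong sum (List.map-cong-local (All.applyUpTo⁺₁ suc n (length-fibre-suc n)))) ⟩
  d n + sum (map (λ i → d (n ∸ i) * a pat21-2→2 (i ∸ 1)) (applyUpTo suc n))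
    ∎
  where open ≡-Reasoning
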